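{- For every positive integer $n$, all $a,b,c\in\mathcal{B}_n$ and all partial bijections $\alpha_1,\alpha_2$ of $n$, $$(a,c)\bullet(\alpha_1\ast\alpha_2)=\big((a,b)\bullet\alpha_1\big)\ast\big((b,c)\bullet\alpha_2\big).$$
   Context: For $n\ge1$ let $\rho(k)=\{2k-1,2k\}$ and let $\mathbf{P}_n$ be the set of subsets of $[2n]$ that are unions of sets $\rho(k)$, $1\le k\le n$. A partial bijection of $n$ is a triple $\alpha=(\sigma,d,d')$ with $d,d'\in\mathbf{P}_n$ and $\sigma:d\to d'$ a bijection; $Q_n$ is the set of these. Coset-type $ct(\alpha)$: take a graph with vertex set $d$, vertex $x$ having exterior label $x$ and interior label $\sigma(x)$; join by an exterior edge the vertices with exterior labels $2i-1,2i$ and by an interior edge the vertices with interior labels $2i-1,2i$; the graph is a disjoint union of cycles of lengths $2\mu_1\ge2\mu_2\ge\cdots$ and $ct(\alpha)=(\mu_1,\mu_2,\dots)$. For partitions, $\lambda\cup\mu$ adds multiplicities and $(1^j)$ has $j$ parts equal to $1$. $(\tilde\sigma,\tilde d,\tilde d')$ is a trivial extension of $(\sigma,d,d')$ if $d\subseteq\tilde d$, $\tilde\sigma|_d=\sigma$ and $ct(\tilde\sigma)=ct(\sigma)\cup(1^{|\tilde d\setminus d|/2})$; $P_\alpha(n)$ is the set of trivial extensions in $Q_n$. For $\alpha_i=(\sigma_i,d_i,d_i')\in Q_n$, let $E=\{(\tilde\alpha_1,\tilde\alpha_2)\in P_{\alpha_1}(n)\times P_{\alpha_2}(n):\tilde d_1=\tilde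 d_2'=d_1\cup d_2'\}$ and $\alpha_1\ast\alpha_2=\frac1{|E|}\sum_{(\tilde\alpha_1,\tilde\alpha_2)\in E}(\tilde\sigma_1\circ\tilde\sigma_2,\tilde d_2,\tilde d_1')\in\mathbb{C}[Q_n]$. $\mathcal{B}_n$ is the hyperoctahedral group: permutations $w$ of $[2n]$ such that for each $k$ there is $k'$ with $w(\rho(k))=\rho(k')$. $\mathcal{B}_n\times\mathcal{B}_n$ acts on $Q_n$ by $(a,b)\bullet(\sigma,d,d')=(a\sigma b^{ -1},b(d),a(d'))$, extended linearly to $\mathbb{C}[Q_n]$. -}

module Defs where

open import Data.Nat using (ℕ; zero; suc; _+_; _*_; _/_; _≡ᵇ_)
open import Data.Fin using (Fin; zero; suc) renaming (_≟_ to _≟F_)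
open import Data.Bool using (Bool; true; false; _∧_; _∨_; not; _xor_; if_then_else_; T)
open import Data.Maybe using (Maybe; nothing; just; is-just; _>>=_) renaming (map to mapMaybe)
import Data.Maybe.Properties as MP
import Data.Product.Properties as PP
open import Data.List using (List; []; _∷_; allFin; map; concatMap; cartesianProduct; filterᵇ; length; upTo; foldr)
open import Data.Bool.ListAction using (all; any)
open import Data.Product using (Σ; _×_; _,_; proj₁; proj₂; ∃; uncurry)
open import Data.Integer using (+_)
open import Data.Rational using (ℚ; 0ℚ) renaming (_+_ to _+ℚ_; _/_ to _/ℚ_)
open import Function.Bundles using (_↔_; Inverse)
open import Relation.Nullary using (does)
open import Relation.Binary.PropositionalEquality using (_≡_)

-- Points of [2n].  We encode the point 2k-1 as (k , 0) and 2k as (k , 1)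
-- (with k ∈ Fin n, i.e. 0-based), so that ρ(k) = {(k,0),(k,1)}.

Pt : ℕ → Set
Pt n = Fin n × Fin 2

allPts : (n : ℕ) → List (Pt n)
allPts n = cartesianProduct (allFin n) (allFin 2)

eqP : {n : ℕ} → Pt n → Pt n → Bool
eqP x y = does (PP.≡-dec _≟F_ _≟F_ x y)

eqM : {n : ℕ} → Maybe (Pt n) → Maybe (Pt n) → Bool
eqM x y = does (MP.≡-dec (PP.≡-dec _≟F_ _≟F_) x y)

allB : (n : ℕ) → (Pt n → Bool) → Bool
allB n p = all p (allPts n)

anyB : (n : ℕ) → (Pt n → Bool) → Bool
anyB n p = any p (allPts n)

countB : (n : ℕ) → (Pt n → Bool) → ℕ
countB n p = length (filterᵇ p (allPts n))

beq : Bool → Bool → Bool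
beq a b = not (a xor b)

flip2 : Fin 2 → Fin 2
flip2 zero = suc zero
flip2 (suc _) = zero

partner : {n : ℕ} → Pt n → Pt n
partner (k , i) = (k , flip2 i)

-- Partial maps.  A partial bijection (σ, d, d') is encoded by the partial
-- map σ : Pt n → Maybe (Pt n) (σ x = nothing iff x ∉ d); d is its domain
-- and d' its image.

PMap : ℕ → Set
PMap n = Pt n → Maybe (Pt n)

inDom : {n : ℕ} → PMap n → Pt n → Bool
inDom σ x = is-just (σ x)

inImg : {n : ℕ} → PMap n → Pt n → Bool
inImg {n} σ y = anyB n (λ x → eqM (σ x) (just y))

isPB : {n : ℕ} → PMap n → Bool
isPB {n} σ =
  allB n (λ x → allB n (λ y → not (inDom σ x ∧ eqM (σ x) (σ y)) ∨ eqP x y))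
  ∧ allB n (λ x → beq (inDom σ x) (inDom σ (partner x)))
  ∧ allB n (λ x → beq (inImg σ x) (inImg σ (partner x)))

Q : ℕ → Set
Q n = Σ (PMap n) (λ σ → T (isPB σ))

-- Coset-type.  Graph on d: exterior edge x — partner x; interior edge
-- x — y when σ x, σ y form a block ρ(i), i.e. σ y = partner (σ x).

preimage : {n : ℕ} → PMap n → Pt n → Pt n → Pt n
preimage {n} σ dflt z = foldr (λ y r → if eqM (σ y) (just z) then y else r) dflt (allPts n)

intN : {n : ℕ} → PMap n → Pt n → Pt n
intN σ x with σ x
... | nothing = x
... | just z  = preimage σ x (partner z)

stepT : {n : ℕ} → PMap n → Pt n → Pt n
stepT σ x = intN σ (partner x)

iterT : {n : ℕ} → PMap n → ℕ → Pt n → Pt n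
iterT σ zero x = x
iterT σ (suc j) x = stepT σ (iterT σ j x)

-- y lies on the cycle through x: walking the cycle from x one visits
-- x, ext x, stepT x, ext (stepT x), ... (at most 2n vertices)
onCycle : {n : ℕ} → PMap n → Pt n → Pt n → Bool
onCycle {n} σ x y = any (λ j → eqP y (iterT σ j x) ∨ eqP y (partner (iterT σ j x))) (upTo (2 * n + 1))

cycleSize : {n : ℕ} → PMap n → Pt n → ℕ
cycleSize {n} σ x = countB n (onCycle σ x)

-- partitions are represented by their multiplicity functions:
-- p m = number of parts equal to m (m ≥ 1; the value at 0 is 0)
Partition : Set
Partition = ℕ → ℕ

-- ct(σ): multiplicity of the part m = number of cycles of length 2m
--       = (number of vertices lying on cycles of length 2m) / (2m)
ct : {n : ℕ} → PMap n → Partition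
ct σ zero = 0
ct {n} σ (suc m) = countB n (λ x → inDom σ x ∧ (cycleSize σ x ≡ᵇ 2 * suc m)) / (2 * suc m)

_∪ₚ_ : Partition → Partition → Partition
(p ∪ₚ q) m = p m + q m

ones : ℕ → Partition
ones j (suc zero) = j
ones j _ = 0

-- equality of partitions arising from Q_n: all parts are ≤ 2n (at most 2n
-- vertices), so it suffices to compare multiplicities of m ≤ 2n + 1
eqPart : ℕ → Partition → Partition → Bool
eqPart n p q = all (λ m → p m ≡ᵇ q m) (upTo (2 * n + 2))

isTrivExt : {n : ℕ} → PMap n → PMap n → Bool
isTrivExt {n} σ σ' =
  isPB σ'
  ∧ allB n (λ x → not (inDom σ x) ∨ (inDom σ' x ∧ eqM (σ' x) (σ x)))
  ∧ eqPart n (ct σ') (ct σ ∪ₚ ones (countB n (λ x → inDom σ' x ∧ not (inDom σ x)) / 2))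

allFunsFin : {B : Set} → (m : ℕ) → List B → List (Fin m → B)
allFunsFin zero bs = (λ ()) ∷ []
allFunsFin (suc m) bs =
  concatMap (λ b → map (λ f → λ { zero → b ; (suc i) → f i }) (allFunsFin m bs)) bs

allPMaps : (n : ℕ) → List (PMap n)
allPMaps n = map uncurry (allFunsFin n (allFunsFin 2 (nothing ∷ map just (allPts n))))

trivExts : {n : ℕ} → PMap n → List (PMap n)
trivExts {n} σ = filterᵇ (isTrivExt σ) (allPMaps n)

-- Formal ℚ-linear combinations of partial maps (elements of ℂ[Q_n]; all
-- coefficients occurring are rational) as lists of (coefficient, basis
-- element); equality is equality of all coefficients.

FSum : ℕ → Set
FSum n = List (ℚ × PMap n)

eqPM : {n : ℕ} → PMap n → PMap n → Bool
eqPM {n} σ τ = allB n (λ x → eqM (σ x) (τ x))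

coeff : {n : ℕ} → FSum n → PMap n → ℚ
coeff L β = foldr (λ qγ r → if eqPM (proj₂ qγ) β then proj₁ qγ +ℚ r else r) 0ℚ L

_≋_ : {n : ℕ} → FSum n → FSum n → Set
_≋_ {n} L M = (β : PMap n) → coeff L β ≡ coeff M β

-- 1/k (k = |E| is always ≥ 1; the value at 0 is irrelevant)
inv : ℕ → ℚ
inv zero = 0ℚ
inv (suc k) = (+ 1) /ℚ (suc k)

compose : {n : ℕ} → PMap n → PMap n → PMap n
compose τ σ x = σ x >>= τ

Eset : {n : ℕ} → PMap n → PMap n → List (PMap n × PMap n)
Eset {n} σ₁ σ₂ =
  filterᵇ (λ t → allB n (λ x →
              beq (inDom (proj₁ t) x) (inDom σ₁ x ∨ inImg σ₂ x)
            ∧ beq (inImg (proj₂ t) x) (inDom σ₁ x ∨ inImg σ₂ x)))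
          (cartesianProduct (trivExts σ₁) (trivExts σ₂))

star : {n : ℕ} → PMap n → PMap n → FSum n
star σ₁ σ₂ = map (λ t → (inv (length E) , compose (proj₁ t) (proj₂ t))) E
  where E = Eset σ₁ σ₂

B : ℕ → Set
B n = Σ (Pt n ↔ Pt n) (λ w →
        (k : Fin n) → ∃ λ k' →
          ((i : Fin 2) → proj₁ (Inverse.to w (k , i)) ≡ k')
          × ((j : Fin 2) → ∃ λ i → Inverse.to w (k , i) ≡ (k' , j)))

act : {n : ℕ} → B n → B n → PMap n → PMap n
act a b σ x = mapMaybe (Inverse.to (proj₁ a)) (σ (Inverse.from (proj₁ b) x))

actF : {n : ℕ} → B n → B n → FSum n → FSum n
actF a b L = map (λ qγ → (proj₁ qγ , act a b (proj₂ qγ))) L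

-- The action of (a, b) is conjugation σ ↦ a σ b⁻¹ by block-preserving
-- permutations. Conjugation preserves everything α₁ ∗ α₂ is built from: being a
-- partial bijection, the cycle graph (hence the coset-type), trivial extensions
-- and the condition defining E; and conjugating by (a, b) and (b, c) turns
-- τ₁ ∘ τ₂ into (a, c) • (τ₁ ∘ τ₂). So (τ₁, τ₂) ↦ ((a, b) • τ₁, (b, c) • τ₂) maps
-- E(α₁, α₂) bijectively onto E((a, b) • α₁, (b, c) • α₂), and both sides of the
-- identity have the same normalisation 1/|E| and the same multiplicities.
-- Partial maps are functions, so this bijection only holds up to pointwise
-- equality; it is realised by double counting over the enumeration allPMaps.

module Submission where

open import Defs
open import Data.Nat using (ℕ; _≤_; zero; suc; _+_; _*_; _/_; _≡ᵇ_)
open import Data.Nat.Properties using (+-assoc; +-comm; *-comm; *-identityʳ; *-distribˡ-+; *-zeroʳ; +-identityʳ)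
open import Data.Product using (proj₁; proj₂; _,_; Σ; _×_; uncurry)
open import Data.Fin using (Fin; zero; suc) renaming (_≟_ to _≟F_)
open import Data.Bool using (Bool; true; false; _∧_; _∨_; not; if_then_else_)
open import Data.Bool.Properties using (⇔→≡; T-≡; ∧-conicalˡ; ∧-conicalʳ)
open import Data.Bool.ListAction using (and; or; all; any)
open import Data.Maybe using (Maybe; just; nothing; is-just; _>>=_) renaming (map to mapMaybe)
import Data.Maybe.Properties as Maybeₚ
import Data.Product.Properties as Productₚ
open import Data.List using (List; []; _∷_; map; filterᵇ; length; foldr; concatMap; cartesianProduct; upTo; _++_)
open import Data.List.Properties using (map-∘; map-cong)
open import Data.List.Membership.Propositional using (_∈_; lose)
import Data.List.Membership.Propositional.Properties as Membershipₚ
open import Data.List.Relation.Unary.Any using (here; there; satisfied)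
open import Data.List.Relation.Unary.Any.Properties using (any⁺; any⁻)
open import Data.List.Relation.Unary.All using (All; []; _∷_; tabulate) renaming (lookup to All-lookup)
open import Data.List.Relation.Unary.All.Properties using (all⁺; all⁻)
open import Data.List.Relation.Unary.AllPairs using (_∷_)
open import Data.List.Relation.Unary.Unique.Propositional using (Unique)
import Data.List.Relation.Unary.Unique.Propositional.Properties as Uniqueₚ
open import Data.Sum using (_⊎_; inj₁; inj₂)
open import Data.Empty using (⊥-elim)
open import Data.Rational using (ℚ; 0ℚ) renaming (_+_ to _+ℚ_)
open import Function.Bundles using (Inverse; mk⇔; Equivalence)
open import Function.Definitions using (Injective)
open import Relation.Binary.Core using (_Preserves_⟶_)
open import Relation.Binary.Definitions using (DecidableEquality)
open import Relation.Binary.Structures using (IsEquivalence)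
open import Relation.Nullary using (¬_; Dec; yes; no; does)
open import Relation.Nullary.Decidable using (dec-true)
open import Relation.Binary.PropositionalEquality hiding ([_]) renaming (isEquivalence to ≡-isEquivalence)

-- Finite sums

[_] : Bool → ℕ
[ true ] = 1
[ false ] = 0

[a∧b]≡[a]*[b] : ∀ a b → [ a ∧ b ] ≡ [ a ] * [ b ]
[a∧b]≡[a]*[b] true b = sym (+-identityʳ [ b ])
[a∧b]≡[a]*[b] false b = refl

≡false⇒∧≡false : ∀ {a b} → a ≡ false → a ∧ b ≡ false
≡false⇒∧≡false refl = refl

⇔true⇒≡ : {a b : Bool} → (a ≡ true → b ≡ true) → (b ≡ true → a ≡ true) → a ≡ b
⇔true⇒≡ f g = ⇔→≡ (mk⇔ f g)

does-true⇒ : ∀ {P : Set} (d : Dec P) → does d ≡ true → P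
does-true⇒ (yes p) _ = p

private variable X Y : Set

sumOver : List X → (X → ℕ) → ℕ
sumOver [] F = 0
sumOver (x ∷ L) F = F x + sumOver L F

sumOver-cong : (L : List X) {F G : X → ℕ} → (∀ x → F x ≡ G x) → sumOver L F ≡ sumOver L G
sumOver-cong [] h = refl
sumOver-cong (x ∷ L) h = cong₂ _+_ (h x) (sumOver-cong L h)

sumOver-0 : (L : List X) → sumOver L (λ _ → 0) ≡ 0
sumOver-0 [] = refl
sumOver-0 (_ ∷ L) = sumOver-0 L

sumOver-++ : (L M : List X) (F : X → ℕ) → sumOver (L ++ M) F ≡ sumOver L F + sumOver M F
sumOver-++ [] M F = refl
sumOver-++ (x ∷ L) M F = trans (cong (F x +_) (sumOver-++ L M F)) (sym (+-assoc (F x) _ _))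

sumOver-+ : (L : List X) (F G : X → ℕ) → sumOver L (λ x → F x + G x) ≡ sumOver L F + sumOver L G
sumOver-+ [] F G = refl
sumOver-+ (x ∷ L) F G = trans (cong (F x + G x +_) (sumOver-+ L F G)) (interchange (F x) (G x) _ _)
  where
  interchange : ∀ a b c d → a + b + (c + d) ≡ a + c + (b + d)
  interchange a b c d = begin
    a + b + (c + d)   ≡⟨ +-assoc a b (c + d) ⟩
    a + (b + (c + d)) ≡⟨ cong (a +_) (sym (+-assoc b c d)) ⟩
    a + (b + c + d)   ≡⟨ cong (λ e → a + (e + d)) (+-comm b c) ⟩
    a + (c + b + d)   ≡⟨ cong (a +_) (+-assoc c b d) ⟩
    a + (c + (b + d)) ≡⟨ sym (+-assoc a c (b + d)) ⟩
    a + c + (b + d)   ∎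
    where open ≡-Reasoning

sumOver-*ˡ : (L : List X) (c : ℕ) (F : X → ℕ) → sumOver L (λ x → c * F x) ≡ c * sumOver L F
sumOver-*ˡ [] c F = sym (*-zeroʳ c)
sumOver-*ˡ (x ∷ L) c F = trans (cong (c * F x +_) (sumOver-*ˡ L c F)) (sym (*-distribˡ-+ c (F x) (sumOver L F)))

sumOver-filter : (p : X → Bool) (L : List X) (F : X → ℕ) → sumOver (filterᵇ p L) F ≡ sumOver L (λ x → [ p x ] * F x)
sumOver-filter p [] F = refl
sumOver-filter p (x ∷ L) F with p x
... | true = cong₂ _+_ (sym (+-identityʳ (F x))) (sumOver-filter p L F)
... | false = sumOver-filter p L F

length≡sumOver-1 : (L : List X) → length L ≡ sumOver L (λ _ → 1)
length≡sumOver-1 [] = refl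
length≡sumOver-1 (x ∷ L) = cong suc (length≡sumOver-1 L)

length-filterᵇ≡sumOver : (p : X → Bool) (L : List X) → length (filterᵇ p L) ≡ sumOver L (λ x → [ p x ])
length-filterᵇ≡sumOver p L = trans (length≡sumOver-1 (filterᵇ p L))
  (trans (sumOver-filter p L (λ _ → 1)) (sumOver-cong L (λ x → *-identityʳ [ p x ])))

sumOver-map : (L : List X) (h : X → Y) (F : Y → ℕ) → sumOver (map h L) F ≡ sumOver L (λ x → F (h x))
sumOver-map [] h F = refl
sumOver-map (x ∷ L) h F = cong (F (h x) +_) (sumOver-map L h F)

sumOver-concatMap : (L : List X) (g : X → List Y) (F : Y → ℕ) →
  sumOver (concatMap g L) F ≡ sumOver L (λ x → sumOver (g x) F)
sumOver-concatMap [] g F = refl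
sumOver-concatMap (x ∷ L) g F =
  trans (sumOver-++ (g x) (concatMap g L) F) (cong (sumOver (g x) F +_) (sumOver-concatMap L g F))

sumOver-cartesianProduct : (L : List X) (M : List Y) (F : X × Y → ℕ) →
  sumOver (cartesianProduct L M) F ≡ sumOver L (λ x → sumOver M (λ y → F (x , y)))
sumOver-cartesianProduct [] M F = refl
sumOver-cartesianProduct (x ∷ L) M F = trans (sumOver-++ (map (x ,_) M) _ F)
  (cong₂ _+_ (sumOver-map M (x ,_) F) (sumOver-cartesianProduct L M F))

sumOver-comm : (L : List X) (M : List Y) (G : X → Y → ℕ) →
  sumOver L (λ x → sumOver M (G x)) ≡ sumOver M (λ y → sumOver L (λ x → G x y))
sumOver-comm [] M G = sym (sumOver-0 M)
sumOver-comm (x ∷ L) M G =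
  trans (cong (sumOver M (G x) +_) (sumOver-comm L M G)) (sym (sumOver-+ M (G x) _))

-- Enumerations

module _ {X : Set} (_≟_ : DecidableEquality X) where

  count-≟-absent : ∀ {x} (L : List X) → All (λ y → ¬ x ≡ y) L → sumOver L (λ y → [ does (y ≟ x) ]) ≡ 0
  count-≟-absent [] [] = refl
  count-≟-absent {x} (y ∷ L) (x≢y ∷ h) with y ≟ x
  ... | yes y≡x = ⊥-elim (x≢y (sym y≡x))
  ... | no _ = count-≟-absent L h

  count-≟-unique : ∀ {x} (L : List X) → Unique L → x ∈ L → sumOver L (λ y → [ does (y ≟ x) ]) ≡ 1
  count-≟-unique {x} (y ∷ L) (y∉L ∷ U) x∈y∷L with y ≟ x | x∈y∷L
  ... | yes refl | _ = cong suc (count-≟-absent L y∉L)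
  ... | no y≢x | here x≡y = ⊥-elim (y≢x (sym x≡y))
  ... | no _ | there x∈L = count-≟-unique L U x∈L

module Enumeration {X : Set} {_≈_ : X → X → Set} (≈-isEquivalence : IsEquivalence _≈_)
  (_≈ᵇ_ : X → X → Bool) (≈ᵇ⇒≈ : ∀ {x y} → x ≈ᵇ y ≡ true → x ≈ y) (≈⇒≈ᵇ : ∀ {x y} → x ≈ y → x ≈ᵇ y ≡ true)
  (L : List X) (enumerates : ∀ x → sumOver L (λ y → [ y ≈ᵇ x ]) ≡ 1) where

  open IsEquivalence ≈-isEquivalence using () renaming (sym to ≈-sym; trans to ≈-trans)

  sumOver-select : (F : X → ℕ) → F Preserves _≈_ ⟶ _≡_ →
    ∀ z → sumOver L (λ y → [ y ≈ᵇ z ] * F y) ≡ F z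
  sumOver-select F F-resp z = begin
    sumOver L (λ y → [ y ≈ᵇ z ] * F y) ≡⟨ sumOver-cong L selected ⟩
    sumOver L (λ y → F z * [ y ≈ᵇ z ]) ≡⟨ sumOver-*ˡ L (F z) _ ⟩
    F z * sumOver L (λ y → [ y ≈ᵇ z ]) ≡⟨ cong (F z *_) (enumerates z) ⟩
    F z * 1                            ≡⟨ *-identityʳ (F z) ⟩
    F z                                ∎
    where
    open ≡-Reasoning
    selected : ∀ y → [ y ≈ᵇ z ] * F y ≡ F z * [ y ≈ᵇ z ]
    selected y with y ≈ᵇ z in eq
    ... | true = trans (+-identityʳ (F y)) (trans (F-resp (≈ᵇ⇒≈ eq)) (sym (*-identityʳ (F z))))
    ... | false = sym (*-zeroʳ (F z))

  sumOver-reindex : (f g : X → X) → g Preserves _≈_ ⟶ _≈_ → f Preserves _≈_ ⟶ _≈_ →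
    (∀ x → f (g x) ≈ x) → (∀ x → g (f x) ≈ x) →
    (F : X → ℕ) → F Preserves _≈_ ⟶ _≡_ → sumOver L (λ x → F (f x)) ≡ sumOver L F
  sumOver-reindex f g g-resp f-resp fg gf F F-resp = begin
    sumOver L (λ x → F (f x))                                ≡⟨ sumOver-cong L (λ x → sym (sumOver-select F F-resp (f x))) ⟩
    sumOver L (λ x → sumOver L (λ y → [ y ≈ᵇ f x ] * F y))   ≡⟨ sumOver-comm L L _ ⟩
    sumOver L (λ y → sumOver L (λ x → [ y ≈ᵇ f x ] * F y))   ≡⟨ sumOver-cong L (λ y → sumOver-cong L (λ x → swap-test x y)) ⟩
    sumOver L (λ y → sumOver L (λ x → F y * [ x ≈ᵇ g y ]))   ≡⟨ sumOver-cong L (λ y → sumOver-*ˡ L (F y) _) ⟩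
    sumOver L (λ y → F y * sumOver L (λ x → [ x ≈ᵇ g y ]))   ≡⟨ sumOver-cong L (λ y → cong (F y *_) (enumerates (g y))) ⟩
    sumOver L (λ y → F y * 1)                                ≡⟨ sumOver-cong L (λ y → *-identityʳ (F y)) ⟩
    sumOver L F                                              ∎
    where
    open ≡-Reasoning
    swap-test : ∀ x y → [ y ≈ᵇ f x ] * F y ≡ F y * [ x ≈ᵇ g y ]
    swap-test x y = trans (cong (λ b → [ b ] * F y) (⇔true⇒≡
      (λ t → ≈⇒≈ᵇ (≈-sym (≈-trans (g-resp (≈ᵇ⇒≈ t)) (gf x))))
      (λ t → ≈⇒≈ᵇ (≈-sym (≈-trans (f-resp (≈ᵇ⇒≈ t)) (fg y))))))
      (*-comm [ x ≈ᵇ g y ] (F y))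

module _ (p : X → Bool) (L : List X) where

  all≡true⇒ : all p L ≡ true → ∀ {x} → x ∈ L → p x ≡ true
  all≡true⇒ h x∈L = Equivalence.to T-≡ (All-lookup (all⁺ p L (Equivalence.from T-≡ h)) x∈L)

  ⇒all≡true : (∀ x → p x ≡ true) → all p L ≡ true
  ⇒all≡true h = Equivalence.to T-≡ (all⁻ p {L} (tabulate (λ {x} _ → Equivalence.from T-≡ (h x))))

  any≡true⇒ : any p L ≡ true → Σ X (λ x → p x ≡ true)
  any≡true⇒ h with x , px ← satisfied (any⁻ p L (Equivalence.from T-≡ h)) = x , Equivalence.to T-≡ px

  ⇒any≡true : ∀ {x} → x ∈ L → p x ≡ true → any p L ≡ true
  ⇒any≡true x∈L px = Equivalence.to T-≡ (any⁺ p (lose x∈L (Equivalence.from T-≡ px)))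

pointwiseᵇ : (Y → Y → Bool) → (m : ℕ) → (Fin m → Y) → (Fin m → Y) → Bool
pointwiseᵇ _≈ᵇ_ zero f g = true
pointwiseᵇ _≈ᵇ_ (suc m) f g = (f zero ≈ᵇ g zero) ∧ pointwiseᵇ _≈ᵇ_ m (λ i → f (suc i)) (λ i → g (suc i))

module _ (_≈ᵇ_ : Y → Y → Bool) where

  pointwiseᵇ⇒ : ∀ m {f g} → pointwiseᵇ _≈ᵇ_ m f g ≡ true → ∀ i → (f i ≈ᵇ g i) ≡ true
  pointwiseᵇ⇒ (suc m) h zero = ∧-conicalˡ _ _ h
  pointwiseᵇ⇒ (suc m) h (suc i) = pointwiseᵇ⇒ m (∧-conicalʳ _ _ h) i

  ⇒pointwiseᵇ : ∀ m {f g} → (∀ i → (f i ≈ᵇ g i) ≡ true) → pointwiseᵇ _≈ᵇ_ m f g ≡ true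
  ⇒pointwiseᵇ zero h = refl
  ⇒pointwiseᵇ (suc m) h rewrite h zero = ⇒pointwiseᵇ m (λ i → h (suc i))

  allFunsFin-enumerates : (bs : List Y) → (∀ c → sumOver bs (λ b → [ b ≈ᵇ c ]) ≡ 1) →
    ∀ m g → sumOver (allFunsFin m bs) (λ f → [ pointwiseᵇ _≈ᵇ_ m f g ]) ≡ 1
  allFunsFin-enumerates bs bs-enum zero g = refl
  allFunsFin-enumerates bs bs-enum (suc m) g = begin
    sumOver (allFunsFin (suc m) bs) (λ f → [ pointwiseᵇ _≈ᵇ_ (suc m) f g ])
      ≡⟨ trans (sumOver-concatMap bs _ _) (sumOver-cong bs (λ b →
           trans (sumOver-map (allFunsFin m bs) _ _) (sumOver-cong (allFunsFin m bs) (λ f → [a∧b]≡[a]*[b] (b ≈ᵇ g zero) _)))) ⟩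
    sumOver bs (λ b → sumOver (allFunsFin m bs) (λ f → [ b ≈ᵇ g zero ] * [ pointwiseᵇ _≈ᵇ_ m f (λ i → g (suc i)) ]))
      ≡⟨ sumOver-cong bs (λ b → sumOver-*ˡ (allFunsFin m bs) [ b ≈ᵇ g zero ] _) ⟩
    sumOver bs (λ b → [ b ≈ᵇ g zero ] * sumOver (allFunsFin m bs) (λ f → [ pointwiseᵇ _≈ᵇ_ m f (λ i → g (suc i)) ]))
      ≡⟨ sumOver-cong bs (λ b → trans (cong ([ b ≈ᵇ g zero ] *_) (allFunsFin-enumerates bs bs-enum m _)) (*-identityʳ _)) ⟩
    sumOver bs (λ b → [ b ≈ᵇ g zero ])
      ≡⟨ bs-enum (g zero) ⟩
    1 ∎
    where
    open ≡-Reasoning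

≗-isEquivalence : IsEquivalence (_≗_ {A = X} {B = Y})
≗-isEquivalence = record
  { refl = λ _ → refl
  ; sym = λ f≗g x → sym (f≗g x)
  ; trans = λ f≗g g≗h x → trans (f≗g x) (g≗h x)
  }

module _ {n : ℕ} where

  _≟ₚ_ : DecidableEquality (Pt n)
  _≟ₚ_ = Productₚ.≡-dec _≟F_ _≟F_

  eqP⇒≡ : ∀ {x y : Pt n} → eqP x y ≡ true → x ≡ y
  eqP⇒≡ {x} {y} = does-true⇒ (x ≟ₚ y)

  ≡⇒eqP : ∀ {x y : Pt n} → x ≡ y → eqP x y ≡ true
  ≡⇒eqP {x} {y} = dec-true (x ≟ₚ y)

  eqM⇒≡ : ∀ {u v : Maybe (Pt n)} → eqM u v ≡ true → u ≡ v
  eqM⇒≡ {u} {v} = does-true⇒ (Maybeₚ.≡-dec _≟ₚ_ u v)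

  ≡⇒eqM : ∀ {u v : Maybe (Pt n)} → u ≡ v → eqM u v ≡ true
  ≡⇒eqM {u} {v} = dec-true (Maybeₚ.≡-dec _≟ₚ_ u v)

  ∈-allPts : (x : Pt n) → x ∈ allPts n
  ∈-allPts (k , i) = Membershipₚ.∈-cartesianProduct⁺ (Membershipₚ.∈-allFin k) (Membershipₚ.∈-allFin i)

  allPts-enumerates : ∀ x → sumOver (allPts n) (λ y → [ eqP y x ]) ≡ 1
  allPts-enumerates x = count-≟-unique _≟ₚ_ (allPts n)
    (Uniqueₚ.cartesianProduct⁺ (Uniqueₚ.allFin⁺ n) (Uniqueₚ.allFin⁺ 2)) (∈-allPts x)

  module Points = Enumeration ≡-isEquivalence eqP eqP⇒≡ ≡⇒eqP (allPts n) allPts-enumerates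

  allB⇒ : ∀ {p : Pt n → Bool} → allB n p ≡ true → ∀ x → p x ≡ true
  allB⇒ {p} h x = all≡true⇒ p (allPts n) h (∈-allPts x)

  ⇒allB : ∀ {p : Pt n → Bool} → (∀ x → p x ≡ true) → allB n p ≡ true
  ⇒allB {p} = ⇒all≡true p (allPts n)

  allB-cong : ∀ {p q : Pt n → Bool} → p ≗ q → allB n p ≡ allB n q
  allB-cong p≗q = cong and (map-cong p≗q (allPts n))

  anyB-cong : ∀ {p q : Pt n → Bool} → p ≗ q → anyB n p ≡ anyB n q
  anyB-cong p≗q = cong or (map-cong p≗q (allPts n))

  countB-cong : ∀ {p q : Pt n → Bool} → p ≗ q → countB n p ≡ countB n q
  countB-cong {p} {q} p≗q = trans (length-filterᵇ≡sumOver p (allPts n))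
    (trans (sumOver-cong (allPts n) (λ x → cong [_] (p≗q x))) (sym (length-filterᵇ≡sumOver q (allPts n))))

  module _ (f g : Pt n → Pt n) (fg : ∀ x → f (g x) ≡ x) (gf : ∀ x → g (f x) ≡ x) where

    countB-∘-bijection : (p : Pt n → Bool) → countB n (λ x → p (f x)) ≡ countB n p
    countB-∘-bijection p = begin
      countB n (λ x → p (f x))           ≡⟨ length-filterᵇ≡sumOver _ (allPts n) ⟩
      sumOver (allPts n) (λ x → [ p (f x) ]) ≡⟨ Points.sumOver-reindex f g (cong g) (cong f) fg gf (λ x → [ p x ]) (cong (λ x → [ p x ])) ⟩
      sumOver (allPts n) (λ x → [ p x ]) ≡⟨ sym (length-filterᵇ≡sumOver p (allPts n)) ⟩
      countB n p                         ∎
      where open ≡-Reasoning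

    allB-∘-bijection : (p : Pt n → Bool) → allB n (λ x → p (f x)) ≡ allB n p
    allB-∘-bijection p = ⇔true⇒≡
      (λ h → ⇒allB (λ y → subst (λ z → p z ≡ true) (fg y) (allB⇒ h (g y))))
      (λ h → ⇒allB (λ x → allB⇒ h (f x)))

    anyB-∘-bijection : (p : Pt n → Bool) → anyB n (λ x → p (f x)) ≡ anyB n p
    anyB-∘-bijection p = ⇔true⇒≡
      (λ h → let x , px = any≡true⇒ _ (allPts n) h in ⇒any≡true p (allPts n) (∈-allPts (f x)) px)
      (λ h → let y , py = any≡true⇒ p (allPts n) h in
             ⇒any≡true _ (allPts n) (∈-allPts (g y)) (subst (λ z → p z ≡ true) (sym (fg y)) py))

  eqPM⇒≗ : ∀ {σ τ : PMap n} → eqPM σ τ ≡ true → σ ≗ τ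
  eqPM⇒≗ h x = eqM⇒≡ (allB⇒ h x)

  ≗⇒eqPM : ∀ {σ τ : PMap n} → σ ≗ τ → eqPM σ τ ≡ true
  ≗⇒eqPM σ≗τ = ⇒allB (λ x → ≡⇒eqM (σ≗τ x))

  eqPM-cong : ∀ {σ σ′ : PMap n} (β : PMap n) → σ ≗ σ′ → eqPM σ β ≡ eqPM σ′ β
  eqPM-cong β σ≗σ′ = allB-cong (λ x → cong (λ u → eqM u (β x)) (σ≗σ′ x))

  maybePts-enumerates : ∀ u → sumOver (nothing ∷ map just (allPts n)) (λ v → [ eqM v u ]) ≡ 1
  maybePts-enumerates nothing = cong suc (trans (sumOver-map (allPts n) just _) (sumOver-0 (allPts n)))
  maybePts-enumerates (just z) = trans (sumOver-map (allPts n) just _) (allPts-enumerates z)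

  allPMaps-enumerates : ∀ β → sumOver (allPMaps n) (λ τ → [ eqPM τ β ]) ≡ 1
  allPMaps-enumerates β = begin
    sumOver (allPMaps n) (λ τ → [ eqPM τ β ])
      ≡⟨ sumOver-map (allFunsFin n rows) uncurry _ ⟩
    sumOver (allFunsFin n rows) (λ h → [ eqPM (uncurry h) β ])
      ≡⟨ sumOver-cong (allFunsFin n rows) (λ h → cong [_] (eqPM-uncurry h)) ⟩
    sumOver (allFunsFin n rows) (λ h → [ pointwiseᵇ eqRow n h β′ ])
      ≡⟨ allFunsFin-enumerates eqRow rows (allFunsFin-enumerates eqM (nothing ∷ map just (allPts n)) maybePts-enumerates 2) n β′ ⟩
    1 ∎
    where
    open ≡-Reasoning
    rows = allFunsFin 2 (nothing ∷ map just (allPts n))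
    eqRow = pointwiseᵇ eqM 2
    β′ : Fin n → Fin 2 → Maybe (Pt n)
    β′ k i = β (k , i)
    eqPM-uncurry : ∀ h → eqPM (uncurry h) β ≡ pointwiseᵇ eqRow n h β′
    eqPM-uncurry h = ⇔true⇒≡
      (λ t → ⇒pointwiseᵇ eqRow n (λ k → ⇒pointwiseᵇ eqM 2 {h k} {β′ k} (λ i → allB⇒ t (k , i))))
      (λ t → ⇒allB (λ (k , i) → pointwiseᵇ⇒ eqM 2 {h k} {β′ k} (pointwiseᵇ⇒ eqRow n {h} {β′} t k) i))

  module PartialMaps = Enumeration ≗-isEquivalence eqPM eqPM⇒≗ ≗⇒eqPM (allPMaps n) allPMaps-enumerates

-- Block permutations and conjugation

record BlockPerm (n : ℕ) : Set where
  field
    to from : Pt n → Pt n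
    to-from : ∀ x → to (from x) ≡ x
    from-to : ∀ x → from (to x) ≡ x
    to-partner : ∀ x → to (partner x) ≡ partner (to x)

  from-partner : ∀ x → from (partner x) ≡ partner (from x)
  from-partner x = begin
    from (partner x)               ≡⟨ cong (λ y → from (partner y)) (sym (to-from x)) ⟩
    from (partner (to (from x)))   ≡⟨ cong from (sym (to-partner (from x))) ⟩
    from (to (partner (from x)))   ≡⟨ from-to (partner (from x)) ⟩
    partner (from x)               ∎
    where open ≡-Reasoning

  to-injective : Injective _≡_ _≡_ to
  to-injective {x} {y} tx≡ty = trans (sym (from-to x)) (trans (cong from tx≡ty) (from-to y))

open BlockPerm

inverse : ∀ {n} → BlockPerm n → BlockPerm n
inverse H = record { to = from H ; from = to H ; to-from = from-to H ; from-to = to-from H ; to-partner = from-partner H }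

identity : ∀ {n} → BlockPerm n
identity = record { to = λ x → x ; from = λ x → x ; to-from = λ _ → refl ; from-to = λ _ → refl ; to-partner = λ _ → refl }

same-block⇒partner : ∀ {n} (u v : Pt n) → proj₁ u ≡ proj₁ v → ¬ u ≡ v → v ≡ partner u
same-block⇒partner (k , zero) (.k , zero) refl u≢v = ⊥-elim (u≢v refl)
same-block⇒partner (k , zero) (.k , suc zero) refl _ = refl
same-block⇒partner (k , suc zero) (.k , zero) refl _ = refl
same-block⇒partner (k , suc zero) (.k , suc zero) refl u≢v = ⊥-elim (u≢v refl)

flip2-≢ : (i : Fin 2) → ¬ i ≡ flip2 i
flip2-≢ zero ()
flip2-≢ (suc zero) ()

blockPerm : ∀ {n} → B n → BlockPerm n
blockPerm {n} (w , preserves-blocks) = record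
  { to = to-w ; from = from-w
  ; to-from = Inverse.strictlyInverseˡ w ; from-to = Inverse.strictlyInverseʳ w
  ; to-partner = to-partner-w }
  where
  to-w = Inverse.to w
  from-w = Inverse.from w
  to-partner-w : ∀ x → to-w (partner x) ≡ partner (to-w x)
  to-partner-w (k , i) = same-block⇒partner (to-w (k , i)) (to-w (k , flip2 i))
    (trans (same-image i) (sym (same-image (flip2 i))))
    (λ e → flip2-≢ i (cong proj₂ (trans (sym (Inverse.strictlyInverseʳ w (k , i)))
                                  (trans (cong from-w e) (Inverse.strictlyInverseʳ w (k , flip2 i))))))
    where
    same-image = proj₁ (proj₂ (preserves-blocks k))

conj : ∀ {n} → BlockPerm n → BlockPerm n → PMap n → PMap n
conj H₁ H₂ σ x = mapMaybe (to H₁) (σ (from H₂ x))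

-- For H₁ = H₂ = identity this is pointwise equality, so the invariance lemmas
-- below double as congruences.
record Conjugate {n} (H₁ H₂ : BlockPerm n) (σ′ σ : PMap n) : Set where
  constructor conjugate
  field pointwise : σ′ ≗ conj H₁ H₂ σ

open Conjugate

module _ {n : ℕ} {f : Pt n → Pt n} (f-injective : Injective _≡_ _≡_ f) where

  eqP-injective : ∀ x y → eqP (f x) (f y) ≡ eqP x y
  eqP-injective x y = ⇔true⇒≡ (λ h → ≡⇒eqP (f-injective (eqP⇒≡ h))) (λ h → ≡⇒eqP (cong f (eqP⇒≡ h)))

  eqM-map-injective : ∀ u v → eqM (mapMaybe f u) (mapMaybe f v) ≡ eqM u v
  eqM-map-injective u v = ⇔true⇒≡
    (λ h → ≡⇒eqM {u = u} {v = v} (Maybeₚ.map-injective f-injective (eqM⇒≡ {u = mapMaybe f u} {v = mapMaybe f v} h)))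
    (λ h → ≡⇒eqM (cong (mapMaybe f) (eqM⇒≡ {u = u} {v = v} h)))

is-just-map : (f : X → Y) (u : Maybe X) → is-just (mapMaybe f u) ≡ is-just u
is-just-map f nothing = refl
is-just-map f (just x) = refl

module _ {n : ℕ} (σ : PMap n) where

  isPB⇒injective : isPB σ ≡ true → ∀ {x y z} → σ x ≡ just z → σ y ≡ just z → x ≡ y
  isPB⇒injective pb {x} {y} σx≡z σy≡z =
    eqP⇒≡ (eliminate (cong is-just σx≡z) (≡⇒eqM (trans σx≡z (sym σy≡z))) (allB⇒ (allB⇒ (∧-conicalˡ _ _ pb) x) y))
    where
    eliminate : ∀ {a b c} → a ≡ true → b ≡ true → not (a ∧ b) ∨ c ≡ true → c ≡ true
    eliminate refl refl h = h

  foldr-preimage-spec : ∀ d z (L : List (Pt n)) →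
    let r = foldr (λ y r → if eqM (σ y) (just z) then y else r) d L in
    σ r ≡ just z ⊎ (r ≡ d × ∀ y → y ∈ L → eqM (σ y) (just z) ≡ false)
  foldr-preimage-spec d z [] = inj₂ (refl , λ _ ())
  foldr-preimage-spec d z (y ∷ L) with eqM (σ y) (just z) in eq
  ... | true = inj₁ (eqM⇒≡ eq)
  ... | false with foldr-preimage-spec d z L
  ...   | inj₁ found = inj₁ found
  ...   | inj₂ (r≡d , absent) = inj₂ (r≡d , λ { y′ (here refl) → eq ; y′ (there y′∈L) → absent y′ y′∈L })

  preimage-spec : ∀ d z → σ (preimage σ d z) ≡ just z ⊎ (preimage σ d z ≡ d × ∀ y → ¬ σ y ≡ just z)
  preimage-spec d z with foldr-preimage-spec d z (allPts n)
  ... | inj₁ found = inj₁ found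
  ... | inj₂ (r≡d , absent) = inj₂ (r≡d , λ y σy≡z → false≢true (trans (sym (absent y (∈-allPts y))) (≡⇒eqM σy≡z)))
    where
    false≢true : ¬ false ≡ true
    false≢true ()

  intN-just : ∀ x z → σ x ≡ just z → intN σ x ≡ preimage σ x (partner z)
  intN-just x z σx≡z rewrite σx≡z = refl

  intN-nothing : ∀ x → σ x ≡ nothing → intN σ x ≡ x
  intN-nothing x σx≡nothing rewrite σx≡nothing = refl

module Conjugation {n : ℕ} (H₁ H₂ : BlockPerm n) where
  private
    to₁ = to H₁
    from₁ = from H₁
    to₂ = to H₂
    from₂ = from H₂

  allB-from₁ : (p : Pt n → Bool) → allB n (λ x → p (from₁ x)) ≡ allB n p
  allB-from₁ = allB-∘-bijection from₁ to₁ (from-to H₁) (to-from H₁)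

  allB-from₂ : (p : Pt n → Bool) → allB n (λ x → p (from₂ x)) ≡ allB n p
  allB-from₂ = allB-∘-bijection from₂ to₂ (from-to H₂) (to-from H₂)

  countB-from₂ : (p : Pt n → Bool) → countB n (λ x → p (from₂ x)) ≡ countB n p
  countB-from₂ = countB-∘-bijection from₂ to₂ (from-to H₂) (to-from H₂)

  eqM-conj : ∀ {σ′ σ τ′ τ : PMap n} → Conjugate H₁ H₂ σ′ σ → Conjugate H₁ H₂ τ′ τ →
    ∀ x y → eqM (σ′ x) (τ′ y) ≡ eqM (σ (from₂ x)) (τ (from₂ y))
  eqM-conj {σ = σ} {τ = τ} Rσ Rτ x y = trans (cong₂ eqM (pointwise Rσ x) (pointwise Rτ y))
    (eqM-map-injective (to-injective H₁) (σ (from₂ x)) (τ (from₂ y)))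

  module _ {σ′ σ : PMap n} (R : Conjugate H₁ H₂ σ′ σ) where

    inDom-conj : ∀ x → inDom σ′ x ≡ inDom σ (from₂ x)
    inDom-conj x = trans (cong is-just (pointwise R x)) (is-just-map to₁ _)

    inImg-conj : ∀ z → inImg σ′ z ≡ inImg σ (from₁ z)
    inImg-conj z = trans (anyB-cong eqM-just) (anyB-∘-bijection from₂ to₂ (from-to H₂) (to-from H₂) _)
      where
      eqM-just : ∀ x → eqM (σ′ x) (just z) ≡ eqM (σ (from₂ x)) (just (from₁ z))
      eqM-just x = trans (cong₂ eqM (pointwise R x) (cong just (sym (to-from H₁ z))))
        (eqM-map-injective (to-injective H₁) (σ (from₂ x)) (just (from₁ z)))

    isPB-conj : isPB σ′ ≡ isPB σ
    isPB-conj = cong₂ _∧_ injective-conj (cong₂ _∧_ domain-blocks-conj image-blocks-conj)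
      where
      injective-conj = begin
        allB n (λ x → allB n (λ y → not (inDom σ′ x ∧ eqM (σ′ x) (σ′ y)) ∨ eqP x y))
          ≡⟨ allB-cong (λ x → allB-cong (λ y → cong₂ _∨_ (cong not (cong₂ _∧_ (inDom-conj x) (eqM-conj R R x y)))
                                                         (sym (eqP-injective (to-injective (inverse H₂)) x y)))) ⟩
        allB n (λ x → allB n (λ y → not (inDom σ (from₂ x) ∧ eqM (σ (from₂ x)) (σ (from₂ y))) ∨ eqP (from₂ x) (from₂ y)))
          ≡⟨ allB-cong (λ x → allB-from₂ (λ y → not (inDom σ (from₂ x) ∧ eqM (σ (from₂ x)) (σ y)) ∨ eqP (from₂ x) y)) ⟩
        allB n (λ x → allB n (λ y → not (inDom σ (from₂ x) ∧ eqM (σ (from₂ x)) (σ y)) ∨ eqP (from₂ x) y))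
          ≡⟨ allB-from₂ (λ x → allB n (λ y → not (inDom σ x ∧ eqM (σ x) (σ y)) ∨ eqP x y)) ⟩
        allB n (λ x → allB n (λ y → not (inDom σ x ∧ eqM (σ x) (σ y)) ∨ eqP x y))
          ∎
        where open ≡-Reasoning
      domain-blocks-conj =
        trans (allB-cong (λ x → cong₂ beq (inDom-conj x) (trans (inDom-conj (partner x)) (cong (inDom σ) (from-partner H₂ x)))))
              (allB-from₂ (λ x → beq (inDom σ x) (inDom σ (partner x))))
      image-blocks-conj =
        trans (allB-cong (λ x → cong₂ beq (inImg-conj x) (trans (inImg-conj (partner x)) (cong (inImg σ) (from-partner H₁ x)))))
              (allB-from₁ (λ x → beq (inImg σ x) (inImg σ (partner x))))

  module _ {σ′ σ : PMap n} (R : Conjugate H₁ H₂ σ′ σ) (pb : isPB σ ≡ true) where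

    private
      pb′ : isPB σ′ ≡ true
      pb′ = trans (isPB-conj R) pb

      σ′-to₂ : ∀ y → σ′ (to₂ y) ≡ mapMaybe to₁ (σ y)
      σ′-to₂ y = trans (pointwise R (to₂ y)) (cong (λ u → mapMaybe to₁ (σ u)) (from-to H₂ y))

    -- preimage returns the first preimage in a fixed enumeration of points,
    -- which is conjugation-invariant only because σ is injective.
    preimage-conj : ∀ d w → preimage σ′ d (to₁ w) ≡ to₂ (preimage σ (from₂ d) w)
    preimage-conj d w with preimage-spec σ (from₂ d) w | preimage-spec σ′ d (to₁ w)
    ... | inj₁ found | inj₁ found′ = isPB⇒injective σ′ pb′ found′ (trans (σ′-to₂ _) (cong (mapMaybe to₁) found))
    ... | inj₁ found | inj₂ (_ , absent′) = ⊥-elim (absent′ _ (trans (σ′-to₂ _) (cong (mapMaybe to₁) found)))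
    ... | inj₂ (_ , absent) | inj₁ found′ =
      ⊥-elim (absent _ (Maybeₚ.map-injective (to-injective H₁) (trans (sym (pointwise R _)) found′)))
    ... | inj₂ (r≡d , _) | inj₂ (r′≡d , _) = trans r′≡d (trans (sym (to-from H₂ d)) (cong to₂ (sym r≡d)))

    intN-conj : ∀ x → intN σ′ x ≡ to₂ (intN σ (from₂ x))
    intN-conj x = by-value (σ (from₂ x)) refl
      where
      open ≡-Reasoning
      by-value : ∀ u → σ (from₂ x) ≡ u → intN σ′ x ≡ to₂ (intN σ (from₂ x))
      by-value nothing eq = begin
        intN σ′ x                      ≡⟨ intN-nothing σ′ x (trans (pointwise R x) (cong (mapMaybe to₁) eq)) ⟩
        x                              ≡⟨ sym (to-from H₂ x) ⟩
        to₂ (from₂ x)                  ≡⟨ cong to₂ (sym (intN-nothing σ (from₂ x) eq)) ⟩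
        to₂ (intN σ (from₂ x))         ∎
      by-value (just z) eq = begin
        intN σ′ x                                  ≡⟨ intN-just σ′ x (to₁ z) (trans (pointwise R x) (cong (mapMaybe to₁) eq)) ⟩
        preimage σ′ x (partner (to₁ z))            ≡⟨ cong (preimage σ′ x) (sym (to-partner H₁ z)) ⟩
        preimage σ′ x (to₁ (partner z))            ≡⟨ preimage-conj x (partner z) ⟩
        to₂ (preimage σ (from₂ x) (partner z))     ≡⟨ cong to₂ (sym (intN-just σ (from₂ x) z eq)) ⟩
        to₂ (intN σ (from₂ x))                     ∎

    iterT-conj : ∀ j x → iterT σ′ j x ≡ to₂ (iterT σ j (from₂ x))
    iterT-conj zero x = sym (to-from H₂ x)
    iterT-conj (suc j) x = begin
      stepT σ′ (iterT σ′ j x)                              ≡⟨ cong (stepT σ′) (iterT-conj j x) ⟩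
      intN σ′ (partner (to₂ y))                            ≡⟨ intN-conj _ ⟩
      to₂ (intN σ (from₂ (partner (to₂ y))))               ≡⟨ cong (λ u → to₂ (intN σ u)) (from-partner H₂ (to₂ y)) ⟩
      to₂ (intN σ (partner (from₂ (to₂ y))))               ≡⟨ cong (λ u → to₂ (stepT σ u)) (from-to H₂ y) ⟩
      to₂ (stepT σ y)                                      ∎
      where
      open ≡-Reasoning
      y = iterT σ j (from₂ x)

    onCycle-conj : ∀ x y → onCycle σ′ x y ≡ onCycle σ (from₂ x) (from₂ y)
    onCycle-conj x y = cong or (map-cong (λ j → cong₂ _∨_
      (trans (cong (eqP y) (iterT-conj j x)) (eqP-to₂ _))
      (trans (cong (eqP y) (trans (cong partner (iterT-conj j x)) (sym (to-partner H₂ _)))) (eqP-to₂ _))) (upTo (2 * n + 1)))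
      where
      eqP-to₂ : ∀ u → eqP y (to₂ u) ≡ eqP (from₂ y) u
      eqP-to₂ u = trans (cong (λ v → eqP v (to₂ u)) (sym (to-from H₂ y))) (eqP-injective (to-injective H₂) (from₂ y) u)

    cycleSize-conj : ∀ x → cycleSize σ′ x ≡ cycleSize σ (from₂ x)
    cycleSize-conj x = trans (countB-cong (onCycle-conj x)) (countB-from₂ (onCycle σ (from₂ x)))

    ct-conj : ∀ m → ct σ′ m ≡ ct σ m
    ct-conj zero = refl
    ct-conj (suc m) = cong (_/ (2 * suc m))
      (trans (countB-cong (λ x → cong₂ _∧_ (inDom-conj R x) (cong (_≡ᵇ 2 * suc m) (cycleSize-conj x))))
             (countB-from₂ (λ x → inDom σ x ∧ (cycleSize σ x ≡ᵇ 2 * suc m))))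

  isTrivExt-conj : ∀ {σ′ σ τ′ τ : PMap n} → Conjugate H₁ H₂ σ′ σ → isPB σ ≡ true → Conjugate H₁ H₂ τ′ τ →
    isTrivExt σ′ τ′ ≡ isTrivExt σ τ
  isTrivExt-conj {σ′} {σ} {τ′} {τ} Rσ pbσ Rτ = by-value (isPB τ) refl
    where
    restriction-conj =
      trans (allB-cong (λ x → cong₂ _∨_ (cong not (inDom-conj Rσ x)) (cong₂ _∧_ (inDom-conj Rτ x) (eqM-conj Rτ Rσ x x))))
            (allB-from₂ (λ x → not (inDom σ x) ∨ (inDom τ x ∧ eqM (τ x) (σ x))))
    new-points-conj =
      trans (countB-cong (λ x → cong₂ _∧_ (inDom-conj Rτ x) (cong not (inDom-conj Rσ x))))
            (countB-from₂ (λ x → inDom τ x ∧ not (inDom σ x)))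
    by-value : ∀ b → isPB τ ≡ b → isTrivExt σ′ τ′ ≡ isTrivExt σ τ
    by-value false pbτ = trans (≡false⇒∧≡false (trans (isPB-conj Rτ) pbτ)) (sym (≡false⇒∧≡false pbτ))
    by-value true pbτ = cong₂ _∧_ (isPB-conj Rτ) (cong₂ _∧_ restriction-conj type-conj)
      where
      type-conj = cong and (map-cong (λ m → cong₂ _≡ᵇ_ (ct-conj Rτ pbτ m)
        (cong₂ _+_ (ct-conj Rσ pbσ m) (cong (λ j → ones (j / 2) m) new-points-conj))) (upTo (2 * n + 2)))

module _ {n : ℕ} where

  Conjugate-identity⇒≗ : ∀ {σ′ σ : PMap n} → Conjugate identity identity σ′ σ → σ′ ≗ σ
  Conjugate-identity⇒≗ {σ = σ} R x = trans (pointwise R x) (Maybeₚ.map-id (σ x))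

  ≗⇒Conjugate-identity : ∀ {σ′ σ : PMap n} → σ′ ≗ σ → Conjugate identity identity σ′ σ
  ≗⇒Conjugate-identity {σ = σ} σ′≗σ = conjugate (λ x → trans (σ′≗σ x) (sym (Maybeₚ.map-id (σ x))))

  conj-Conjugate : ∀ (H₁ H₂ : BlockPerm n) σ → Conjugate H₁ H₂ (conj H₁ H₂ σ) σ
  conj-Conjugate H₁ H₂ σ = conjugate (λ _ → refl)

  conj-cong : ∀ (H₁ H₂ : BlockPerm n) → (conj H₁ H₂) Preserves _≗_ ⟶ _≗_
  conj-cong H₁ H₂ τ≗τ′ x = cong (mapMaybe (to H₁)) (τ≗τ′ (from H₂ x))

  conj-inverse : ∀ (H₁ H₂ : BlockPerm n) τ → conj H₁ H₂ (conj (inverse H₁) (inverse H₂) τ) ≗ τ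
  conj-inverse H₁ H₂ τ x = begin
    mapMaybe (to H₁) (mapMaybe (from H₁) (τ (to H₂ (from H₂ x))))
      ≡⟨ sym (Maybeₚ.map-∘ (τ (to H₂ (from H₂ x)))) ⟩
    mapMaybe (λ y → to H₁ (from H₁ y)) (τ (to H₂ (from H₂ x)))
      ≡⟨ Maybeₚ.map-cong (to-from H₁) (τ (to H₂ (from H₂ x))) ⟩
    mapMaybe (λ y → y) (τ (to H₂ (from H₂ x)))
      ≡⟨ Maybeₚ.map-id (τ (to H₂ (from H₂ x))) ⟩
    τ (to H₂ (from H₂ x))
      ≡⟨ cong τ (to-from H₂ x) ⟩
    τ x ∎
    where open ≡-Reasoning

  sumOver-allPMaps-conj : ∀ (H₁ H₂ : BlockPerm n) (F : PMap n → ℕ) → F Preserves _≗_ ⟶ _≡_ →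
    sumOver (allPMaps n) F ≡ sumOver (allPMaps n) (λ ρ → F (conj H₁ H₂ ρ))
  sumOver-allPMaps-conj H₁ H₂ F F-resp = sym (PartialMaps.sumOver-reindex
    (conj H₁ H₂) (conj (inverse H₁) (inverse H₂)) (conj-cong (inverse H₁) (inverse H₂)) (conj-cong H₁ H₂)
    (conj-inverse H₁ H₂) (conj-inverse (inverse H₁) (inverse H₂)) F F-resp)

  isTrivExt-cong : ∀ (σ : PMap n) {τ τ′} → isPB σ ≡ true → τ ≗ τ′ → isTrivExt σ τ ≡ isTrivExt σ τ′
  isTrivExt-cong σ pb τ≗τ′ = Conjugation.isTrivExt-conj identity identity
    (≗⇒Conjugate-identity (λ _ → refl)) pb (≗⇒Conjugate-identity τ≗τ′)

  compose-conj : ∀ {Ha Hb Hc : BlockPerm n} {τ₁′ τ₁ τ₂′ τ₂} →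
    Conjugate Ha Hb τ₁′ τ₁ → Conjugate Hb Hc τ₂′ τ₂ → Conjugate Ha Hc (compose τ₁′ τ₂′) (compose τ₁ τ₂)
  compose-conj {Ha} {Hb} {Hc} {τ₁′} {τ₁} {τ₂′} {τ₂} R₁ R₂ =
    conjugate (λ x → trans (cong (_>>= τ₁′) (pointwise R₂ x)) (bind-conj (τ₂ (from Hc x))))
    where
    bind-conj : ∀ u → (mapMaybe (to Hb) u >>= τ₁′) ≡ mapMaybe (to Ha) (u >>= τ₁)
    bind-conj nothing = refl
    bind-conj (just y) = trans (pointwise R₁ (to Hb y)) (cong (λ v → mapMaybe (to Ha) (τ₁ v)) (from-to Hb y))

  compose-cong : ∀ {τ₁ τ₁′ τ₂ τ₂′ : PMap n} → τ₁ ≗ τ₁′ → τ₂ ≗ τ₂′ → compose τ₁ τ₂ ≗ compose τ₁′ τ₂′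
  compose-cong τ₁≗τ₁′ τ₂≗τ₂′ = Conjugate-identity⇒≗
    (compose-conj (≗⇒Conjugate-identity τ₁≗τ₁′) (≗⇒Conjugate-identity τ₂≗τ₂′))

-- The set E and the coefficients of α₁ ∗ α₂

module _ {n : ℕ} where

  inE : PMap n → PMap n → PMap n → PMap n → Bool
  inE σ₁ σ₂ τ₁ τ₂ = allB n (λ x → beq (inDom τ₁ x) (inDom σ₁ x ∨ inImg σ₂ x) ∧ beq (inImg τ₂ x) (inDom σ₁ x ∨ inImg σ₂ x))

  weightE : PMap n → PMap n → (PMap n → PMap n → ℕ) → PMap n → PMap n → ℕ
  weightE σ₁ σ₂ G τ₁ τ₂ = [ isTrivExt σ₁ τ₁ ] * ([ isTrivExt σ₂ τ₂ ] * ([ inE σ₁ σ₂ τ₁ τ₂ ] * G τ₁ τ₂))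

  sumOver-Eset : ∀ σ₁ σ₂ (G : PMap n → PMap n → ℕ) →
    sumOver (Eset σ₁ σ₂) (uncurry G) ≡ sumOver (allPMaps n) (λ τ₁ → sumOver (allPMaps n) (weightE σ₁ σ₂ G τ₁))
  sumOver-Eset σ₁ σ₂ G = begin
    sumOver (Eset σ₁ σ₂) (uncurry G)
      ≡⟨ sumOver-filter _ (cartesianProduct (trivExts σ₁) (trivExts σ₂)) (uncurry G) ⟩
    sumOver (cartesianProduct (trivExts σ₁) (trivExts σ₂)) (λ t → [ inE σ₁ σ₂ (proj₁ t) (proj₂ t) ] * uncurry G t)
      ≡⟨ sumOver-cartesianProduct (trivExts σ₁) (trivExts σ₂) _ ⟩
    sumOver (trivExts σ₁) (λ τ₁ → sumOver (trivExts σ₂) (λ τ₂ → [ inE σ₁ σ₂ τ₁ τ₂ ] * G τ₁ τ₂))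
      ≡⟨ sumOver-filter (isTrivExt σ₁) (allPMaps n) _ ⟩
    sumOver (allPMaps n) (λ τ₁ → [ isTrivExt σ₁ τ₁ ] * sumOver (trivExts σ₂) (λ τ₂ → [ inE σ₁ σ₂ τ₁ τ₂ ] * G τ₁ τ₂))
      ≡⟨ sumOver-cong (allPMaps n) (λ τ₁ → cong ([ isTrivExt σ₁ τ₁ ] *_) (sumOver-filter (isTrivExt σ₂) (allPMaps n) _)) ⟩
    sumOver (allPMaps n) (λ τ₁ → [ isTrivExt σ₁ τ₁ ] *
      sumOver (allPMaps n) (λ τ₂ → [ isTrivExt σ₂ τ₂ ] * ([ inE σ₁ σ₂ τ₁ τ₂ ] * G τ₁ τ₂)))
      ≡⟨ sumOver-cong (allPMaps n) (λ τ₁ → sym (sumOver-*ˡ (allPMaps n) [ isTrivExt σ₁ τ₁ ] _)) ⟩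
    sumOver (allPMaps n) (λ τ₁ → sumOver (allPMaps n) (weightE σ₁ σ₂ G τ₁)) ∎
    where open ≡-Reasoning

  inE-conj : ∀ {Ha Hb Hc : BlockPerm n} {σ₁′ σ₁ τ₁′ τ₁ σ₂′ σ₂ τ₂′ τ₂} →
    Conjugate Ha Hb σ₁′ σ₁ → Conjugate Ha Hb τ₁′ τ₁ → Conjugate Hb Hc σ₂′ σ₂ → Conjugate Hb Hc τ₂′ τ₂ →
    inE σ₁′ σ₂′ τ₁′ τ₂′ ≡ inE σ₁ σ₂ τ₁ τ₂
  inE-conj {Ha} {Hb} {Hc} {σ₁ = σ₁} {τ₁ = τ₁} {σ₂ = σ₂} {τ₂ = τ₂} Rσ₁ Rτ₁ Rσ₂ Rτ₂ =
    trans (allB-cong (λ x → cong₂ _∧_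
      (cong₂ beq (inDom-conj Rτ₁ x) (cong₂ _∨_ (inDom-conj Rσ₁ x) (inImg-conj Hb Hc Rσ₂ x)))
      (cong₂ beq (inImg-conj Hb Hc Rτ₂ x) (cong₂ _∨_ (inDom-conj Rσ₁ x) (inImg-conj Hb Hc Rσ₂ x)))))
    (allB-from₂ (λ x → beq (inDom τ₁ x) (inDom σ₁ x ∨ inImg σ₂ x) ∧ beq (inImg τ₂ x) (inDom σ₁ x ∨ inImg σ₂ x)))
    where
    open Conjugation Ha Hb using (inDom-conj; allB-from₂)
    open Conjugation using (inImg-conj)

  inE-cong : ∀ (σ₁ σ₂ : PMap n) {τ₁ τ₁′ τ₂ τ₂′} → τ₁ ≗ τ₁′ → τ₂ ≗ τ₂′ → inE σ₁ σ₂ τ₁ τ₂ ≡ inE σ₁ σ₂ τ₁′ τ₂′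
  inE-cong σ₁ σ₂ τ₁≗τ₁′ τ₂≗τ₂′ = inE-conj {identity} {identity} {identity} {σ₁} {σ₁} {σ₂′ = σ₂} {σ₂}
    (≗⇒Conjugate-identity (λ _ → refl)) (≗⇒Conjugate-identity τ₁≗τ₁′)
    (≗⇒Conjugate-identity (λ _ → refl)) (≗⇒Conjugate-identity τ₂≗τ₂′)

  weightE-cong : ∀ σ₁ σ₂ → isPB σ₁ ≡ true → isPB σ₂ ≡ true → (G : PMap n → PMap n → ℕ) →
    (∀ {τ₁ τ₁′ τ₂ τ₂′} → τ₁ ≗ τ₁′ → τ₂ ≗ τ₂′ → G τ₁ τ₂ ≡ G τ₁′ τ₂′) →
    ∀ {τ₁ τ₁′ τ₂ τ₂′} → τ₁ ≗ τ₁′ → τ₂ ≗ τ₂′ → weightE σ₁ σ₂ G τ₁ τ₂ ≡ weightE σ₁ σ₂ G τ₁′ τ₂′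
  weightE-cong σ₁ σ₂ pb₁ pb₂ G G-cong h₁ h₂ =
    cong₂ _*_ (cong [_] (isTrivExt-cong σ₁ pb₁ h₁)) (cong₂ _*_ (cong [_] (isTrivExt-cong σ₂ pb₂ h₂))
      (cong₂ _*_ (cong [_] (inE-cong σ₁ σ₂ h₁ h₂)) (G-cong h₁ h₂)))

  weightE-conj : ∀ (Ha Hb Hc : BlockPerm n) σ₁ σ₂ → isPB σ₁ ≡ true → isPB σ₂ ≡ true →
    (G′ G : PMap n → PMap n → ℕ) → (∀ ρ₁ ρ₂ → G′ (conj Ha Hb ρ₁) (conj Hb Hc ρ₂) ≡ G ρ₁ ρ₂) →
    ∀ ρ₁ ρ₂ → weightE (conj Ha Hb σ₁) (conj Hb Hc σ₂) G′ (conj Ha Hb ρ₁) (conj Hb Hc ρ₂) ≡ weightE σ₁ σ₂ G ρ₁ ρ₂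
  weightE-conj Ha Hb Hc σ₁ σ₂ pb₁ pb₂ G′ G G′-conj ρ₁ ρ₂ =
    cong₂ _*_ (cong [_] (Conjugation.isTrivExt-conj Ha Hb Rσ₁ pb₁ Rρ₁))
      (cong₂ _*_ (cong [_] (Conjugation.isTrivExt-conj Hb Hc Rσ₂ pb₂ Rρ₂))
        (cong₂ _*_ (cong [_] (inE-conj Rσ₁ Rρ₁ Rσ₂ Rρ₂)) (G′-conj ρ₁ ρ₂)))
    where
    Rσ₁ = conj-Conjugate Ha Hb σ₁
    Rσ₂ = conj-Conjugate Hb Hc σ₂
    Rρ₁ = conj-Conjugate Ha Hb ρ₁
    Rρ₂ = conj-Conjugate Hb Hc ρ₂

  sumOver-Eset-conj : ∀ (Ha Hb Hc : BlockPerm n) σ₁ σ₂ → isPB σ₁ ≡ true → isPB σ₂ ≡ true →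
    (G′ G : PMap n → PMap n → ℕ) →
    (∀ {τ₁ τ₁′ τ₂ τ₂′} → τ₁ ≗ τ₁′ → τ₂ ≗ τ₂′ → G′ τ₁ τ₂ ≡ G′ τ₁′ τ₂′) →
    (∀ ρ₁ ρ₂ → G′ (conj Ha Hb ρ₁) (conj Hb Hc ρ₂) ≡ G ρ₁ ρ₂) →
    sumOver (Eset (conj Ha Hb σ₁) (conj Hb Hc σ₂)) (uncurry G′) ≡ sumOver (Eset σ₁ σ₂) (uncurry G)
  sumOver-Eset-conj Ha Hb Hc σ₁ σ₂ pb₁ pb₂ G′ G G′-cong G′-conj = begin
    sumOver (Eset σ₁′ σ₂′) (uncurry G′)
      ≡⟨ sumOver-Eset σ₁′ σ₂′ G′ ⟩
    sumOver (allPMaps n) (λ τ₁ → sumOver (allPMaps n) (w′ τ₁))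
      ≡⟨ sumOver-allPMaps-conj Ha Hb _ (λ h → sumOver-cong (allPMaps n) (λ _ → w′-cong h (λ _ → refl))) ⟩
    sumOver (allPMaps n) (λ ρ₁ → sumOver (allPMaps n) (w′ (conj Ha Hb ρ₁)))
      ≡⟨ sumOver-cong (allPMaps n) (λ ρ₁ → sumOver-allPMaps-conj Hb Hc _ (w′-cong (λ _ → refl))) ⟩
    sumOver (allPMaps n) (λ ρ₁ → sumOver (allPMaps n) (λ ρ₂ → w′ (conj Ha Hb ρ₁) (conj Hb Hc ρ₂)))
      ≡⟨ sumOver-cong (allPMaps n) (λ ρ₁ → sumOver-cong (allPMaps n) (weightE-conj Ha Hb Hc σ₁ σ₂ pb₁ pb₂ G′ G G′-conj ρ₁)) ⟩
    sumOver (allPMaps n) (λ ρ₁ → sumOver (allPMaps n) (weightE σ₁ σ₂ G ρ₁))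
      ≡⟨ sym (sumOver-Eset σ₁ σ₂ G) ⟩
    sumOver (Eset σ₁ σ₂) (uncurry G) ∎
    where
    open ≡-Reasoning
    σ₁′ = conj Ha Hb σ₁
    σ₂′ = conj Hb Hc σ₂
    w′ = weightE σ₁′ σ₂′ G′
    w′-cong = weightE-cong σ₁′ σ₂′ (trans (Conjugation.isPB-conj Ha Hb (conj-Conjugate Ha Hb σ₁)) pb₁)
      (trans (Conjugation.isPB-conj Hb Hc (conj-Conjugate Hb Hc σ₂)) pb₂) G′ G′-cong

  length-Eset-conj : ∀ (Ha Hb Hc : BlockPerm n) σ₁ σ₂ → isPB σ₁ ≡ true → isPB σ₂ ≡ true →
    length (Eset (conj Ha Hb σ₁) (conj Hb Hc σ₂)) ≡ length (Eset σ₁ σ₂)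
  length-Eset-conj Ha Hb Hc σ₁ σ₂ pb₁ pb₂ = trans (length≡sumOver-1 (Eset (conj Ha Hb σ₁) (conj Hb Hc σ₂)))
    (trans (sumOver-Eset-conj Ha Hb Hc σ₁ σ₂ pb₁ pb₂ (λ _ _ → 1) (λ _ _ → 1) (λ _ _ → refl) (λ _ _ → refl))
           (sym (length≡sumOver-1 (Eset σ₁ σ₂))))

  count-Eset-conj : ∀ (Ha Hb Hc : BlockPerm n) σ₁ σ₂ → isPB σ₁ ≡ true → isPB σ₂ ≡ true → ∀ β →
    sumOver (Eset (conj Ha Hb σ₁) (conj Hb Hc σ₂)) (λ t → [ eqPM (uncurry compose t) β ]) ≡
    sumOver (Eset σ₁ σ₂) (λ t → [ eqPM (conj Ha Hc (uncurry compose t)) β ])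
  count-Eset-conj Ha Hb Hc σ₁ σ₂ pb₁ pb₂ β = sumOver-Eset-conj Ha Hb Hc σ₁ σ₂ pb₁ pb₂
    (λ τ₁ τ₂ → [ eqPM (compose τ₁ τ₂) β ]) (λ ρ₁ ρ₂ → [ eqPM (conj Ha Hc (compose ρ₁ ρ₂)) β ])
    (λ h₁ h₂ → cong [_] (eqPM-cong β (compose-cong h₁ h₂)))
    (λ ρ₁ ρ₂ → cong [_] (eqPM-cong β (pointwise (compose-conj (conj-Conjugate Ha Hb ρ₁) (conj-Conjugate Hb Hc ρ₂)))))

scale : ℕ → ℚ → ℚ
scale zero q = 0ℚ
scale (suc k) q = q +ℚ scale k q

coeff-constant : ∀ {n} (β : PMap n) (q : ℚ) (G : X → PMap n) (E : List X) →
  coeff (map (λ t → (q , G t)) E) β ≡ scale (sumOver E (λ t → [ eqPM (G t) β ])) q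
coeff-constant β q G [] = refl
coeff-constant β q G (t ∷ E) with eqPM (G t) β
... | true = cong (q +ℚ_) (coeff-constant β q G E)
... | false = coeff-constant β q G E

corollary3p1 : (n : ℕ) → 1 ≤ n → (a b c : B n) → (α₁ α₂ : Q n) →
    actF a c (star (proj₁ α₁) (proj₁ α₂)) ≋ star (act a b (proj₁ α₁)) (act b c (proj₁ α₂))
corollary3p1 n _ a b c (σ₁ , pb₁) (σ₂ , pb₂) β = begin
  coeff (actF a c (star σ₁ σ₂)) β
    ≡⟨ cong (λ L → coeff L β) (sym (map-∘ E)) ⟩
  coeff (map (λ t → (inv (length E) , act a c (uncurry compose t))) E) β
    ≡⟨ coeff-constant β _ (λ t → act a c (uncurry compose t)) E ⟩
  scale (sumOver E (λ t → [ eqPM (act a c (uncurry compose t)) β ])) (inv (length E))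
    ≡⟨ sym (cong₂ scale (count-Eset-conj Ha Hb Hc σ₁ σ₂ pb₁′ pb₂′ β) (cong inv (length-Eset-conj Ha Hb Hc σ₁ σ₂ pb₁′ pb₂′))) ⟩
  scale (sumOver E′ (λ t → [ eqPM (uncurry compose t) β ])) (inv (length E′))
    ≡⟨ sym (coeff-constant β _ (uncurry compose) E′) ⟩
  coeff (star (act a b σ₁) (act b c σ₂)) β ∎
  where
  open ≡-Reasoning
  -- act a b is definitionally conj (blockPerm a) (blockPerm b).
  Ha = blockPerm a
  Hb = blockPerm b
  Hc = blockPerm c
  E = Eset σ₁ σ₂
  E′ = Eset (act a b σ₁) (act b c σ₂)
  pb₁′ = Equivalence.to T-≡ pb₁
  pb₂′ = Equivalence.to T-≡ pb₂
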